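{- Let $G$ be a bipartite graph. Then $\chi_{\text{lid}}(G)\leq 4$.
   Context: All graphs are finite and simple. For a vertex $u$ of a graph $G$, $N[u]$ denotes its closed neighborhood ($u$ together with its neighbors). For a vertex-coloring $c$ and a set $S$ of vertices, $c(S)$ is the set of colors appearing on $S$. A locally identifying coloring (lid-coloring) of $G$ is a proper vertex-coloring $c$ of $G$ such that for every edge $uv$ with $N[u]\neq N[v]$ we have $c(N[u])\neq c(N[v])$. The lid-chromatic number $\chi_{\text{lid}}(G)$ is the minimum number of colors in a lid-coloring of $G$. -}

module Defs where

open import Data.Nat using (ℕ)
open import Data.Fin using (Fin)
open import Data.Bool using (Bool; true; false)
open import Data.Product using (Σ; _×_; ∃; ∃-syntax)
open import Data.Sum using (_⊎_)
open import Relation.Binary.PropositionalEquality using (_≡_; _≢_)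
open import Relation.Nullary using (¬_)
open import Function.Bundles using (_⇔_)

record Graph (n : ℕ) : Set where
  field
    adj   : Fin n → Fin n → Bool
    sym   : ∀ u v → adj u v ≡ adj v u
    irrefl : ∀ u → adj u u ≡ false

open Graph public

Edge : ∀ {n} → Graph n → Fin n → Fin n → Set
Edge G u v = adj G u v ≡ true

InN : ∀ {n} → Graph n → Fin n → Fin n → Set
InN G u w = (w ≡ u) ⊎ Edge G u w

Bipartite : ∀ {n} → Graph n → Set
Bipartite {n} G = Σ (Fin n → Bool) λ side → ∀ u v → Edge G u v → side u ≢ side v

Proper : ∀ {n} {C : Set} → Graph n → (Fin n → C) → Set
Proper G c = ∀ u v → Edge G u v → c u ≢ c v

ColorIn : ∀ {n} {C : Set} → Graph n → (Fin n → C) → Fin n → C → Set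
ColorIn G c u k = ∃[ w ] (InN G u w × c w ≡ k)

SameN : ∀ {n} → Graph n → Fin n → Fin n → Set
SameN G u v = ∀ w → InN G u w ⇔ InN G v w

SameColors : ∀ {n} {C : Set} → Graph n → (Fin n → C) → Fin n → Fin n → Set
SameColors G c u v = ∀ k → ColorIn G c u k ⇔ ColorIn G c v k

IsLid : ∀ {n} {C : Set} → Graph n → (Fin n → C) → Set
IsLid G c = Proper G c ×
  (∀ u v → Edge G u v → ¬ SameN G u v → ¬ SameColors G c u v)

LidColorableWith : ∀ {n} → Graph n → ℕ → Set
LidColorableWith G k = Σ (Fin _ → Fin k) λ c → IsLid G c

module Submission where

-- Every bipartite graph has a locally identifying colouring with 4 colours:
-- colour each vertex by its BFS level modulo 4.
--
--   * 'cyc-lid': if adjacent vertices lie on adjacent levels (Graded) and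
--     every edge uv with d v = d u + 1 has a neighbour of u below u, a
--     neighbour of v above v, or N[u] = N[v] (Separating), then d mod 4 is a
--     lid-colouring: the colour two levels below v (or above u) occurs around
--     one endpoint but not around the other, whose levels are 1 to 3 away.
--   * 'levelling-separates': a 'Levelling' (graded, roots = local minima, no
--     vertex sees two roots, a root with a pendant neighbour is a leaf) is
--     Separating, since a bad edge would join a root to a pendant vertex.
--   * 'Search.levelling': breadth-first search, one component at a time and
--     rooted at a leaf whenever an unvisited leaf exists, yields a levelling;
--     bipartiteness makes each new BFS layer independent.

open import Defs hiding (sym)
open import Data.Nat using (ℕ; suc; _+_; _<_; z≤n; s≤s; _≟_)
open import Data.Nat.Properties using (suc-injective)
open import Data.Nat.Induction using (<-wellFounded)
open import Data.Fin using (Fin; zero; suc)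
open import Data.Fin.Properties using (any?; all?) renaming (_≟_ to _≟ᶠ_)
open import Data.Fin.Subset using (Subset; ∣_∣; _∈_)
open import Data.Fin.Subset.Properties using (p⊂q⇒∣p∣<∣q∣)
open import Data.Bool using (Bool; true; false; not; _∨_; if_then_else_)
open import Data.Bool.Properties using (¬-not; not-involutive) renaming (_≟_ to _≟ᵇ_)
open import Data.Vec using (tabulate)
open import Data.Vec.Properties using (lookup∘tabulate; []=⇒lookup; lookup⇒[]=)
open import Data.Product using (_×_; _,_; proj₁; proj₂; ∃-syntax)
open import Data.Sum using (_⊎_; inj₁; inj₂; map₂)
open import Data.Empty using (⊥-elim)
open import Function using (_∘_)
open import Function.Bundles using (mk⇔; Equivalence)
import Function.Properties.Equivalence as ⇔
open import Induction.WellFounded using (Acc; acc)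
open import Level using (0ℓ)
open import Relation.Nullary using (¬_; Dec; yes; no; does)
open import Relation.Nullary.Decidable using (_×-dec_; _→-dec_)
open import Relation.Unary using (Pred; Decidable)
open import Relation.Binary.PropositionalEquality
  using (_≡_; _≢_; refl; sym; trans; cong; subst₂)

cyc : ℕ → Fin 4
cyc 0 = zero
cyc 1 = suc zero
cyc 2 = suc (suc zero)
cyc 3 = suc (suc (suc zero))
cyc (suc (suc (suc (suc m)))) = cyc m

cyc-apart-table : ∀ m → (cyc (1 + m) ≢ cyc m) × (cyc (2 + m) ≢ cyc m) × (cyc (3 + m) ≢ cyc m)
cyc-apart-table 0 = (λ ()) , (λ ()) , (λ ())
cyc-apart-table 1 = (λ ()) , (λ ()) , (λ ())
cyc-apart-table 2 = (λ ()) , (λ ()) , (λ ())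
cyc-apart-table 3 = (λ ()) , (λ ()) , (λ ())
cyc-apart-table (suc (suc (suc (suc m)))) = cyc-apart-table m

Apart : ℕ → ℕ → Set
Apart a b = ∃[ j ] j < 3 × b ≡ suc j + a

cyc-apart : ∀ {a b} → Apart a b → cyc b ≢ cyc a
cyc-apart {a} (0 , _ , refl) = proj₁ (cyc-apart-table a)
cyc-apart {a} (1 , _ , refl) = proj₁ (proj₂ (cyc-apart-table a))
cyc-apart {a} (2 , _ , refl) = proj₂ (proj₂ (cyc-apart-table a))
cyc-apart (suc (suc (suc _)) , s≤s (s≤s (s≤s ())) , _)

Adjacent : ℕ → ℕ → Set
Adjacent a b = b ≡ suc a ⊎ a ≡ suc b

adjacent-colours : ∀ {a b} → Adjacent a b → cyc a ≢ cyc b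
adjacent-colours (inj₁ b≡1+a) ca≡cb = cyc-apart (0 , s≤s z≤n , b≡1+a) (sym ca≡cb)
adjacent-colours (inj₂ a≡1+b) ca≡cb = cyc-apart (0 , s≤s z≤n , a≡1+b) ca≡cb

module _ {n : ℕ} (G : Graph n) where

  edge-sym : ∀ {u v} → Edge G u v → Edge G v u
  edge-sym {u} {v} e = trans (Graph.sym G v u) e

  edge-irrefl : ∀ {v} → ¬ Edge G v v
  edge-irrefl {v} e with () ← trans (sym e) (irrefl G v)

  edge? : ∀ u v → Dec (Edge G u v)
  edge? u v = adj G u v ≟ᵇ true

  Leaf : Fin n → Set
  Leaf v = ∃[ u ] Edge G v u × (∀ w → Edge G v w → w ≡ u)

  leaf? : ∀ v → Dec (Leaf v)
  leaf? v = any? λ u → edge? v u ×-dec all? (λ w → edge? v w →-dec (w ≟ᶠ u))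

  -- The only neighbour of a leaf u adjacent to v is v itself, so N[u] ⊆ N[v].
  leaf-neighbourhood : ∀ {u v w} → Edge G u v → Leaf u → InN G u w → InN G v w
  leaf-neighbourhood e _ (inj₁ refl) = inj₂ (edge-sym e)
  leaf-neighbourhood {v = v} {w} e (_ , _ , unique) (inj₂ e′) = inj₁ (trans (unique w e′) (sym (unique v e)))

  leaf-pair : ∀ {u v} → Edge G u v → Leaf u → Leaf v → SameN G u v
  leaf-pair e lu lv w = mk⇔ (leaf-neighbourhood e lu) (leaf-neighbourhood (edge-sym e) lv)

  -- Both 'SameN' and 'SameColors' are symmetric, which lets us orient edges upwards.
  SameN-sym : ∀ {u v} → SameN G u v → SameN G v u
  SameN-sym same w = ⇔.sym (same w)

  SameColors-sym : ∀ {C} {c : Fin n → C} {u v} → SameColors G c u v → SameColors G c v u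
  SameColors-sym same k = ⇔.sym (same k)

  module _ (d : Fin n → ℕ) where

    Graded : Set
    Graded = ∀ {u v} → Edge G u v → Adjacent (d u) (d v)

    Below Above : Fin n → Set
    Below u = ∃[ w ] Edge G u w × suc (d w) ≡ d u
    Above u = ∃[ w ] Edge G u w × d w ≡ suc (d u)

    Separating : Set
    Separating = ∀ {u v} → Edge G u v → d v ≡ suc (d u) → ¬ Below u → ¬ Above v → SameN G u v

    closed-levels : Graded → ∀ {v w} → InN G v w → d w ≡ d v ⊎ Adjacent (d v) (d w)
    closed-levels _ (inj₁ refl) = inj₁ refl
    closed-levels graded (inj₂ e) = inj₂ (graded e)

    absent-from-above : Graded → ∀ {v x} → suc (suc (d x)) ≡ d v → ¬ ColorIn G (cyc ∘ d) v (cyc (d x))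
    absent-from-above graded h (w , w∈N[v] , same) = cyc-apart (gap (closed-levels graded w∈N[v])) same
      where
      gap : d w ≡ d _ ⊎ Adjacent (d _) (d w) → Apart (d _) (d w)
      gap (inj₁ p) = 1 , s≤s (s≤s z≤n) , trans p (sym h)
      gap (inj₂ (inj₁ p)) = 2 , s≤s (s≤s (s≤s z≤n)) , trans p (cong suc (sym h))
      gap (inj₂ (inj₂ p)) = 0 , s≤s z≤n , suc-injective (trans (sym p) (sym h))

    absent-from-below : Graded → ∀ {v x} → suc (suc (d v)) ≡ d x → ¬ ColorIn G (cyc ∘ d) v (cyc (d x))
    absent-from-below graded h (w , w∈N[v] , same) = cyc-apart (gap (closed-levels graded w∈N[v])) (sym same)
      where
      gap : d w ≡ d _ ⊎ Adjacent (d _) (d w) → Apart (d w) (d _)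
      gap (inj₁ p) = 1 , s≤s (s≤s z≤n) , trans (sym h) (cong (2 +_) (sym p))
      gap (inj₂ (inj₁ p)) = 0 , s≤s z≤n , trans (sym h) (cong suc (sym p))
      gap (inj₂ (inj₂ p)) = 2 , s≤s (s≤s (s≤s z≤n)) , trans (sym h) (cong (2 +_) p)

    cyc-lid : Graded → Separating → IsLid G (cyc ∘ d)
    cyc-lid graded separating = (λ u v e → adjacent-colours (graded e)) , lid
      where
      upward : ∀ {u v} → Edge G u v → d v ≡ suc (d u) → SameColors G (cyc ∘ d) u v → SameN G u v
      upward {u} {v} e up same = separating e up nothing-below nothing-above
        where
        nothing-below : ¬ Below u
        nothing-below (w , e′ , down) = absent-from-above graded (trans (cong suc down) (sym up))
          (Equivalence.to (same (cyc (d w))) (w , inj₂ e′ , refl))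
        nothing-above : ¬ Above v
        nothing-above (w , e′ , up′) = absent-from-below graded (trans (cong suc (sym up)) (sym up′))
          (Equivalence.from (same (cyc (d w))) (w , inj₂ e′ , refl))

      lid : ∀ u v → Edge G u v → ¬ SameN G u v → ¬ SameColors G (cyc ∘ d) u v
      lid u v e distinct same with graded e
      ... | inj₁ up = distinct (upward e up same)
      ... | inj₂ down = distinct (SameN-sym (upward (edge-sym e) down (SameColors-sym same)))

    record Levelling : Set where
      field
        graded      : Graded
        descent     : ∀ {v} → d v ≢ 0 → Below v
        roots-apart : ∀ {v z z′} → Edge G v z → Edge G v z′ → d z ≡ 0 → d z′ ≡ 0 → z ≡ z′
        root-leaf   : ∀ {z} → d z ≡ 0 → Leaf z ⊎ (∀ {v} → Edge G z v → ¬ Leaf v)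

    -- An edge violating the alternatives of 'Separating' joins a root u to a
    -- vertex v all of whose neighbours are roots, hence equal to u; so v is a
    -- pendant neighbour of u, u is a leaf too, and uv is a K₂ component.
    levelling-separates : Levelling → Separating
    levelling-separates L {u} {v} e up nothing-below nothing-above = leaf-pair e u-leaf v-leaf
      where
      open Levelling L
      u-root : d u ≡ 0
      u-root with d u ≟ 0
      ... | yes root = root
      ... | no not-root = ⊥-elim (nothing-below (descent not-root))
      only-u : ∀ w → Edge G v w → w ≡ u
      only-u w e′ with graded e′
      ... | inj₁ above = ⊥-elim (nothing-above (w , e′ , above))
      ... | inj₂ below = roots-apart e′ (edge-sym e) (trans (suc-injective (trans (sym below) up)) u-root) u-root
      v-leaf : Leaf v
      v-leaf = u , edge-sym e , only-u
      u-leaf : Leaf u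
      u-leaf with root-leaf u-root
      ... | inj₁ leaf = leaf
      ... | inj₂ no-pendant = ⊥-elim (no-pendant e v-leaf)

-- A search state assigns levels to the visited vertices ('done'); the
-- frontier consists of the visited vertices of level 'depth', all on side
-- 'face', and every edge leaving the visited set starts at the frontier.
module Search {n : ℕ} (G : Graph n) (side : Fin n → Bool)
               (bipartite : ∀ u v → Edge G u v → side u ≢ side v) where

  module _ (done : Fin n → Bool) where

    Touched : Fin n → Set
    Touched v = ∃[ u ] done u ≡ true × Edge G u v

    touched? : ∀ v → Dec (Touched v)
    touched? v = any? λ u → (done u ≟ᵇ true) ×-dec edge? G u v

    -- The set of unvisited vertices; its size is the termination measure.
    todo : Subset n
    todo = tabulate (not ∘ done)

    ∈-todo : ∀ {v} → done v ≡ false → v ∈ todo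
    ∈-todo {v} fresh = lookup⇒[]= v todo (trans (lookup∘tabulate (not ∘ done) v) (cong not fresh))

    ∈-todo⁻ : ∀ {v} → v ∈ todo → done v ≡ false
    ∈-todo⁻ {v} v∈ = trans (sym (not-involutive (done v)))
                          (cong not (trans (sym (lookup∘tabulate (not ∘ done) v)) ([]=⇒lookup v∈)))

  module _ (done : Fin n → Bool) (level : Fin n → ℕ) where

    -- The roots are the visited vertices of level 0, one per explored component.
    Root : Fin n → Set
    Root z = done z ≡ true × level z ≡ 0

    record Invariant (depth : ℕ) (face : Bool) : Set where
      field
        graded      : ∀ {u v} → done u ≡ true → done v ≡ true → Edge G u v → Adjacent (level u) (level v)
        boundary    : ∀ {u v} → done u ≡ true → done v ≡ false → Edge G u v → level u ≡ depth × side u ≡ face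
        descent     : ∀ {v} → done v ≡ true → level v ≢ 0 →
                      ∃[ w ] done w ≡ true × Edge G v w × suc (level w) ≡ level v
        roots-apart : ∀ {v z z′} → Edge G v z → Edge G v z′ → Root z → Root z′ → z ≡ z′
        root-leaf   : ∀ {z} → Root z → Leaf G z ⊎ (∀ {v} → Edge G z v → ¬ Leaf G v)

  module Visit {done : Fin n → Bool} {level : Fin n → ℕ} {depth face}
               (I : Invariant done level depth face)
               {S : Pred (Fin n) 0ℓ} (S? : Decidable S) (l : ℕ) where
    open Invariant I

    done′ : Fin n → Bool
    done′ v = done v ∨ does (S? v)

    level′ : Fin n → ℕ
    level′ v = if done v then level v else l

    stays : ∀ {v} → done v ≡ true → done′ v ≡ true × level′ v ≡ level v
    stays eq rewrite eq = refl , refl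

    arrives : ∀ {v} → done′ v ≡ true → (done v ≡ true × level′ v ≡ level v) ⊎ (done v ≡ false × S v × level′ v ≡ l)
    arrives {v} with done v | S? v
    ... | true  | _     = λ _ → inj₁ (refl , refl)
    ... | false | yes s = λ _ → inj₂ (refl , s , refl)
    ... | false | no _  = λ ()

    waits : ∀ {v} → done′ v ≡ false → done v ≡ false × ¬ S v
    waits {v} with done v | S? v
    ... | true  | _     = λ ()
    ... | false | yes _ = λ ()
    ... | false | no s  = λ _ → refl , s

    shrinks : ∀ {x} → done x ≡ false → S x → ∣ todo done′ ∣ < ∣ todo done ∣
    shrinks {x} fresh s = p⊂q⇒∣p∣<∣q∣ (subset , x , ∈-todo done fresh , λ x∈ → proj₂ (waits (∈-todo⁻ done′ x∈)) s)
      where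
      subset : ∀ {v} → v ∈ todo done′ → v ∈ todo done
      subset v∈ = ∈-todo done (proj₁ (waits (∈-todo⁻ done′ v∈)))

    graded-stays : ∀ {u v} → done u ≡ true → done v ≡ true → Edge G u v → Adjacent (level′ u) (level′ v)
    graded-stays du dv e = subst₂ Adjacent (sym (proj₂ (stays du))) (sym (proj₂ (stays dv))) (graded du dv e)

    descent-stays : ∀ {v} → done v ≡ true → level′ v ≢ 0 →
                    ∃[ w ] done′ w ≡ true × Edge G v w × suc (level′ w) ≡ level′ v
    descent-stays dv nonzero with descent dv (nonzero ∘ trans (proj₂ (stays dv)))
    ... | w , dw , e , down = w , proj₁ (stays dw) , e ,
                              trans (cong suc (proj₂ (stays dw))) (trans down (sym (proj₂ (stays dv))))

  -- Growing the current component: visit every touched vertex at the next level.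
  -- The new layer lies on the opposite side, so it is independent.
  module Grow {done level depth face} (I : Invariant done level depth face) where
    open Invariant I
    open Visit I (touched? done) (suc depth)

    -- A touched vertex has a neighbour on the frontier, so it lies on the
    -- other side and one level deeper.
    arrival-side : ∀ {v} → done v ≡ false → Touched done v → side v ≡ not face
    arrival-side dv (u , du , e) = trans (¬-not (bipartite _ _ (edge-sym G e))) (cong not (proj₂ (boundary du dv e)))

    arrival-level : ∀ {u v} → done u ≡ true → done v ≡ false → Edge G u v → level′ v ≡ suc depth → level′ v ≡ suc (level′ u)
    arrival-level du dv e lv = trans lv (cong suc (trans (sym (proj₁ (boundary du dv e))) (sym (proj₂ (stays du)))))

    graded′ : ∀ {u v} → done′ u ≡ true → done′ v ≡ true → Edge G u v → Adjacent (level′ u) (level′ v)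
    graded′ du dv e with arrives du | arrives dv
    ... | inj₁ (du₀ , _) | inj₁ (dv₀ , _) = graded-stays du₀ dv₀ e
    ... | inj₁ (du₀ , _) | inj₂ (dv₀ , _ , lv) = inj₁ (arrival-level du₀ dv₀ e lv)
    ... | inj₂ (du₀ , _ , lu) | inj₁ (dv₀ , _) = inj₂ (arrival-level dv₀ du₀ (edge-sym G e) lu)
    ... | inj₂ (du₀ , tu , _) | inj₂ (dv₀ , tv , _) =
      ⊥-elim (bipartite _ _ e (trans (arrival-side du₀ tu) (sym (arrival-side dv₀ tv))))

    boundary′ : ∀ {u v} → done′ u ≡ true → done′ v ≡ false → Edge G u v → level′ u ≡ suc depth × side u ≡ not face
    boundary′ du dv e with waits dv | arrives du
    ... | _ , untouched | inj₁ (du₀ , _) = ⊥-elim (untouched (_ , du₀ , e))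
    ... | _ | inj₂ (du₀ , tu , lu) = lu , arrival-side du₀ tu

    descent′ : ∀ {v} → done′ v ≡ true → level′ v ≢ 0 → ∃[ w ] done′ w ≡ true × Edge G v w × suc (level′ w) ≡ level′ v
    descent′ dv nonzero with arrives dv
    ... | inj₁ (dv₀ , _) = descent-stays dv₀ nonzero
    ... | inj₂ (dv₀ , (u , du , e) , lv) = u , proj₁ (stays du) , edge-sym G e , sym (arrival-level du dv₀ e lv)

    -- The new layer has a positive level, so the roots are unchanged.
    old-root : ∀ {z} → Root done′ level′ z → Root done level z
    old-root (dz , lz) with arrives dz
    ... | inj₁ (dz₀ , same) = dz₀ , trans (sym same) lz
    ... | inj₂ (_ , _ , lz′) with () ← trans (sym lz′) lz

    grown : Invariant done′ level′ (suc depth) (not face)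
    grown = record
      { graded      = graded′
      ; boundary    = boundary′
      ; descent     = descent′
      ; roots-apart = λ e e′ z z′ → roots-apart e e′ (old-root z) (old-root z′)
      ; root-leaf   = root-leaf ∘ old-root
      }

  module Plant {done level depth face} (I : Invariant done level depth face)
               (closed : ∀ {u v} → done u ≡ true → done v ≡ false → ¬ Edge G u v)
               {r} (fresh : done r ≡ false)
               (choice : Leaf G r ⊎ (∀ {w} → done w ≡ false → ¬ Leaf G w)) where
    open Invariant I
    open Visit I (_≟ᶠ r) 0

    unvisited-neighbour : ∀ {v w} → done v ≡ false → Edge G v w → done w ≡ false
    unvisited-neighbour {w = w} dv e with done w in dw
    ... | true  = ⊥-elim (closed dw dv (edge-sym G e))
    ... | false = refl

    graded′ : ∀ {u v} → done′ u ≡ true → done′ v ≡ true → Edge G u v → Adjacent (level′ u) (level′ v)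
    graded′ du dv e with arrives du | arrives dv
    ... | inj₁ (du₀ , _) | inj₁ (dv₀ , _) = graded-stays du₀ dv₀ e
    ... | inj₁ (du₀ , _) | inj₂ (_ , refl , _) = ⊥-elim (closed du₀ fresh e)
    ... | inj₂ (_ , refl , _) | inj₁ (dv₀ , _) = ⊥-elim (closed dv₀ fresh (edge-sym G e))
    ... | inj₂ (_ , refl , _) | inj₂ (_ , refl , _) = ⊥-elim (edge-irrefl G e)

    boundary′ : ∀ {u v} → done′ u ≡ true → done′ v ≡ false → Edge G u v → level′ u ≡ 0 × side u ≡ side r
    boundary′ du dv e with waits dv | arrives du
    ... | dv₀ , _ | inj₁ (du₀ , _) = ⊥-elim (closed du₀ dv₀ e)
    ... | _ | inj₂ (_ , refl , lu) = lu , refl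

    descent′ : ∀ {v} → done′ v ≡ true → level′ v ≢ 0 → ∃[ w ] done′ w ≡ true × Edge G v w × suc (level′ w) ≡ level′ v
    descent′ dv nonzero with arrives dv
    ... | inj₁ (dv₀ , _) = descent-stays dv₀ nonzero
    ... | inj₂ (_ , _ , lv) = ⊥-elim (nonzero lv)

    root-view : ∀ {z} → Root done′ level′ z → Root done level z ⊎ z ≡ r
    root-view (dz , lz) with arrives dz
    ... | inj₁ (dz₀ , same) = inj₁ (dz₀ , trans (sym same) lz)
    ... | inj₂ (_ , z≡r , _) = inj₂ z≡r

    -- No vertex sees both an old root and r, since r's neighbours are unvisited.
    not-shared : ∀ {v z} → Edge G v z → Edge G v r → ¬ Root done level z
    not-shared e e′ (dz , _) = closed dz (unvisited-neighbour fresh (edge-sym G e′)) (edge-sym G e)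

    roots-apart′ : ∀ {v z z′} → Edge G v z → Edge G v z′ → Root done′ level′ z → Root done′ level′ z′ → z ≡ z′
    roots-apart′ e e′ z z′ with root-view z | root-view z′
    ... | inj₁ old | inj₁ old′ = roots-apart e e′ old old′
    ... | inj₁ old | inj₂ refl = ⊥-elim (not-shared e e′ old)
    ... | inj₂ refl | inj₁ old′ = ⊥-elim (not-shared e′ e old′)
    ... | inj₂ refl | inj₂ refl = refl

    root-leaf′ : ∀ {z} → Root done′ level′ z → Leaf G z ⊎ (∀ {v} → Edge G z v → ¬ Leaf G v)
    root-leaf′ z with root-view z
    ... | inj₁ old = root-leaf old
    ... | inj₂ refl = map₂ (λ no-leaf e → no-leaf (unvisited-neighbour fresh e)) choice

    planted : Invariant done′ level′ 0 (side r)
    planted = record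
      { graded      = graded′
      ; boundary    = boundary′
      ; descent     = descent′
      ; roots-apart = roots-apart′
      ; root-leaf   = root-leaf′
      }

  initial : Invariant (λ _ → false) (λ _ → 0) 0 false
  initial = record
    { graded = λ () ; boundary = λ () ; descent = λ () ; roots-apart = λ _ _ () ; root-leaf = λ () }

  complete : ∀ {done level depth face} → Invariant done level depth face →
             (∀ v → done v ≡ true) → Levelling G level
  complete I all-done = record
    { graded      = graded (all-done _) (all-done _)
    ; descent     = λ nonzero → let w , _ , e , down = descent (all-done _) nonzero in w , e , down
    ; roots-apart = λ e e′ z z′ → roots-apart e e′ (all-done _ , z) (all-done _ , z′)
    ; root-leaf   = λ z → root-leaf (all-done _ , z)
    }
    where open Invariant I

  next-root : ∀ (done : Fin n → Bool) {x} → done x ≡ false →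
              ∃[ r ] done r ≡ false × (Leaf G r ⊎ (∀ {w} → done w ≡ false → ¬ Leaf G w))
  next-root done {x} fresh with any? (λ w → (done w ≟ᵇ false) ×-dec leaf? G w)
  ... | yes (r , dr , leaf) = r , dr , inj₁ leaf
  ... | no none = x , fresh , inj₂ (λ dw leaf → none (_ , dw , leaf))

  search : ∀ {done level depth face} → Invariant done level depth face →
           Acc _<_ ∣ todo done ∣ → ∃[ d ] Levelling G d
  search {done} {level} {depth} I (acc smaller) with any? (λ v → done v ≟ᵇ false)
  ... | no finished = level , complete I (λ v → ¬-not (λ fresh → finished (v , fresh)))
  ... | yes (x , fresh) with any? (λ v → (done v ≟ᵇ false) ×-dec touched? done v)
  ...   | yes (v , dv , touched) =
          search (Grow.grown I) (smaller (Visit.shrinks I (touched? done) (suc depth) dv touched))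
  ...   | no untouched with next-root done fresh
  ...     | r , dr , choice =
          search (Plant.planted I closed dr choice) (smaller (Visit.shrinks I (_≟ᶠ r) 0 dr refl))
    where
    closed : ∀ {u v} → done u ≡ true → done v ≡ false → ¬ Edge G u v
    closed du dv e = untouched (_ , dv , _ , du , e)

  levelling : ∃[ d ] Levelling G d
  levelling = search initial (<-wellFounded _)

mainTheorem1 : (n : ℕ) (G : Graph n) → Bipartite G → LidColorableWith G 4
mainTheorem1 n G (side , bipartite) with Search.levelling G side bipartite
... | d , L = cyc ∘ d , cyc-lid G d (Levelling.graded L) (levelling-separates G d L)
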